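{- For every positive integer $n$, writing $A_m(n)=\sum_{k=1}^n \binom{2n}{n-k}k^m$, $$\begin{aligned} A_2(n) &= 2^{2n-2}n,\\ A_4(n) &= 2^{2n-3}n(3n-1),\\ A_6(n) &= 2^{2n-4}n(15n^2-15n+4),\\ A_8(n) &= 2^{2n-5}n(105n^3-210n^2+147n-34),\\ A_{10}(n) &= 2^{2n-6}n(945n^4-3150n^3+4095n^2-2370n+496).\end{aligned}$$ -}

module Defs where

open import Data.Nat using (ℕ; suc; _∸_; _^_)
open import Data.Nat.Combinatorics using (_C_)
open import Data.List using (List; map)
open import Data.Nat.ListAction using (sum)
open import Data.List using (upTo)

-- k ranges over 1..n : upTo n = [0..n-1], shift by one.
A : ℕ → ℕ → ℕ
A m n = sum (map (λ i → ((2 * n) C (n ∸ suc i)) * (suc i ^ m)) (upTo n))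
  where open import Data.Nat using (_*_)

open import Data.Integer as ℤ using (ℤ; +_)

-- the integer n, and 2^(2n) = 4^n as an integer
ℤof : ℕ → ℤ
ℤof n = + n

pow4 : ℕ → ℤ
pow4 n = + (4 ^ n)

-- Let S_n(g) = Σ_{k=-n}^{n} C(2n, n-k) g(k). For even m ≥ 2 the summand k^m is
-- symmetric in k and vanishes at k = 0, so S_n(k^m) = 2 A_m(n). Pascal's rule
-- applied twice gives S_{n+1}(g) = S_n(g(k+1) + 2 g(k) + g(k-1)), and by the
-- binomial theorem this operator maps (2k²)^i to a combination of (2k²)^j with
-- j ≤ i. So the sequences S_n((2k²)^i), i ≤ 5, satisfy a triangular linear
-- recurrence in n, and each claimed closed form is confirmed by checking,
-- as a polynomial identity, that it satisfies the same recurrence.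
module Submission where

open import Defs
open import Data.Nat using (ℕ; suc)
open import Data.Integer using (ℤ; +_; _*_; _+_; _-_)
open import Data.Product using (_×_)
open import Relation.Binary.PropositionalEquality using (_≡_)

open import Data.Nat as ℕ using (zero; _∸_)
import Data.Nat.Properties as ℕ
open import Data.Nat.Combinatorics using (_C_; nCk+nC[k+1]≡[n+1]C[k+1])
open import Data.Nat.ListAction using (sum)
import Data.Nat.Tactic.RingSolver as ℕ-Solver
open import Data.List using (List; []; _∷_; applyUpTo)
open import Data.List.Properties using (map-upTo)
open import Data.Fin as Fin using (Fin; toℕ)
open import Data.Fin.Patterns using (0F; 1F; 2F; 3F; 4F; 5F)
open import Data.Integer using (-[1+_]; -_; 0ℤ; 1ℤ; _≤_; +≤+)
import Data.Integer.Properties as ℤ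
open import Data.Integer.Tactic.RingSolver using (ring; solve-∀)
open import Data.Product using (_,_)
open import Function using (_∘_)
open import Relation.Binary.PropositionalEquality
  using (refl; sym; trans; cong; cong₂; _≗_; module ≡-Reasoning)
open import Tactic.RingSolver.Core.AlmostCommutativeRing using (AlmostCommutativeRing)

open ≡-Reasoning

-- Integer powers are those of the ring solver's own ring: it does not
-- recognise Data.Integer._^_.
open AlmostCommutativeRing ring using (_^_; semiring)
open import Algebra.Properties.Semiring.Exp.TCOptimised semiring using (^-homo-*; ^-assocʳ)
open import Algebra.Properties.CommutativeSemigroup ℤ.+-commutativeSemigroup using (interchange)

pos-^ : ∀ k m → + (k ℕ.^ m) ≡ (+ k) ^ m
pos-^ k zero    = refl
pos-^ k (suc m) = begin
  + (k ℕ.* k ℕ.^ m)  ≡⟨ ℤ.pos-* k (k ℕ.^ m) ⟩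
  + k * + (k ℕ.^ m)  ≡⟨ cong (+ k *_) (pos-^ k m) ⟩
  + k * (+ k) ^ m    ≡⟨ ^-homo-* (+ k) 1 m ⟨
  (+ k) ^ suc m      ∎

0^n≡0 : ∀ n .{{_ : ℕ.NonZero n}} → 0ℤ ^ n ≡ 0ℤ
0^n≡0 (suc n) = ^-homo-* 0ℤ 1 n

[-i]^[2m]≡i^[2m] : ∀ i m → (- i) ^ (2 ℕ.* m) ≡ i ^ (2 ℕ.* m)
[-i]^[2m]≡i^[2m] i m = begin
  (- i) ^ (2 ℕ.* m)  ≡⟨ ^-assocʳ (- i) 2 m ⟨
  ((- i) ^ 2) ^ m    ≡⟨ cong (_^ m) (square-neg i) ⟩
  (i ^ 2) ^ m        ≡⟨ ^-assocʳ i 2 m ⟩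
  i ^ (2 ℕ.* m)      ∎
  where
  square-neg : ∀ i → (- i) ^ 2 ≡ i ^ 2
  square-neg = solve-∀

-- binomialSum M g x = Σ_{j=0}^{M} (M C j) · g (x - j).
binomialSum : ℕ → (ℤ → ℤ) → ℤ → ℤ
binomialSum zero    g x = g x
binomialSum (suc M) g x = binomialSum M g x + binomialSum M g (x - 1ℤ)

binomialSum-cong : ∀ {f g} → f ≗ g → ∀ M x → binomialSum M f x ≡ binomialSum M g x
binomialSum-cong f≗g zero    x = f≗g x
binomialSum-cong f≗g (suc M) x =
  cong₂ _+_ (binomialSum-cong f≗g M x) (binomialSum-cong f≗g M (x - 1ℤ))

binomialSum-0 : ∀ M x → binomialSum M (λ _ → 0ℤ) x ≡ 0ℤ
binomialSum-0 zero    x = refl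
binomialSum-0 (suc M) x = cong₂ _+_ (binomialSum-0 M x) (binomialSum-0 M (x - 1ℤ))

binomialSum-+ : ∀ f g M x →
  binomialSum M (λ u → f u + g u) x ≡ binomialSum M f x + binomialSum M g x
binomialSum-+ f g zero    x = refl
binomialSum-+ f g (suc M) x = trans
  (cong₂ _+_ (binomialSum-+ f g M x) (binomialSum-+ f g M (x - 1ℤ)))
  (interchange (binomialSum M f x) (binomialSum M g x) (binomialSum M f (x - 1ℤ)) _)

binomialSum-* : ∀ a f M x → binomialSum M (λ u → a * f u) x ≡ a * binomialSum M f x
binomialSum-* a f zero    x = refl
binomialSum-* a f (suc M) x = trans
  (cong₂ _+_ (binomialSum-* a f M x) (binomialSum-* a f M (x - 1ℤ)))
  (sym (ℤ.*-distribˡ-+ a _ _))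

binomialSum-shift : ∀ g k M x → binomialSum M (λ u → g (u + k)) x ≡ binomialSum M g (x + k)
binomialSum-shift g k zero    x = refl
binomialSum-shift g k (suc M) x = cong₂ _+_
  (binomialSum-shift g k M x)
  (trans (binomialSum-shift g k M (x - 1ℤ)) (cong (binomialSum M g) (swap x k)))
  where
  swap : ∀ x k → x - 1ℤ + k ≡ x + k - 1ℤ
  swap = solve-∀

-- Reflecting the summation index j ↦ M - j turns the mirror image u ↦ h (- u)
-- back into h; over ℤ this needs no boundary cases.
binomialSum-split : ∀ g h → (∀ u → g u ≡ h u + h (- u)) →
  ∀ M x → binomialSum M g x ≡ binomialSum M h x + binomialSum M h (+ M - x)
binomialSum-split g h g≡h+h∘- zero x =
  trans (g≡h+h∘- x) (cong (λ y → h x + h y) (sym (ℤ.+-identityˡ (- x))))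
binomialSum-split g h g≡h+h∘- (suc M) x = begin
  B g x + B g (x - 1ℤ)
    ≡⟨ cong₂ _+_ (binomialSum-split g h g≡h+h∘- M x) (binomialSum-split g h g≡h+h∘- M (x - 1ℤ)) ⟩
  (B h x + B h (+ M - x)) + (B h (x - 1ℤ) + B h (+ M - (x - 1ℤ)))
    ≡⟨ cong₂ (λ y z → (B h x + B h y) + (B h (x - 1ℤ) + B h z)) (reflect₁ (+ M) x) (reflect₂ (+ M) x) ⟩
  (B h x + B h (1ℤ + + M - x - 1ℤ)) + (B h (x - 1ℤ) + B h (1ℤ + + M - x))
    ≡⟨ rearrange (B h x) (B h (1ℤ + + M - x - 1ℤ)) (B h (x - 1ℤ)) (B h (1ℤ + + M - x)) ⟩
  (B h x + B h (x - 1ℤ)) + (B h (1ℤ + + M - x) + B h (1ℤ + + M - x - 1ℤ)) ∎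
  where
  B = binomialSum M
  reflect₁ : ∀ m x → m - x ≡ 1ℤ + m - x - 1ℤ
  reflect₁ = solve-∀
  reflect₂ : ∀ m x → m - (x - 1ℤ) ≡ 1ℤ + m - x
  reflect₂ = solve-∀
  rearrange : ∀ a b c d → (a + b) + (c + d) ≡ (a + c) + (d + b)
  rearrange = solve-∀

linComb : {I : Set} → List (ℤ × I) → (I → ℤ) → ℤ
linComb []                 φ = 0ℤ
linComb ((a , i) ∷ [])     φ = a * φ i
linComb ((a , i) ∷ t ∷ ts) φ = linComb (t ∷ ts) φ + a * φ i

linComb-cong : ∀ {I : Set} (ts : List (ℤ × I)) {φ ψ} → φ ≗ ψ → linComb ts φ ≡ linComb ts ψ
linComb-cong []                 φ≗ψ = refl
linComb-cong ((a , i) ∷ [])     φ≗ψ = cong (a *_) (φ≗ψ i)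
linComb-cong ((a , i) ∷ t ∷ ts) φ≗ψ = cong₂ (λ s y → s + a * y) (linComb-cong (t ∷ ts) φ≗ψ) (φ≗ψ i)

binomialSum-linComb : ∀ {I : Set} (ts : List (ℤ × I)) (h : I → ℤ → ℤ) M x →
  binomialSum M (λ u → linComb ts (λ i → h i u)) x ≡ linComb ts (λ i → binomialSum M (h i) x)
binomialSum-linComb []                 h M x = binomialSum-0 M x
binomialSum-linComb ((a , i) ∷ [])     h M x = binomialSum-* a (h i) M x
binomialSum-linComb ((a , i) ∷ t ∷ ts) h M x = trans
  (binomialSum-+ (λ u → linComb (t ∷ ts) (λ j → h j u)) (λ u → a * h i u) M x)
  (cong₂ _+_ (binomialSum-linComb (t ∷ ts) h M x) (binomialSum-* a (h i) M x))

twoStep : (ℤ → ℤ) → ℤ → ℤ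
twoStep g u = g (u + 1ℤ) + + 2 * g u + g (u - 1ℤ)

binomialSum-twoStep : ∀ g M x → binomialSum (suc (suc M)) g (x + 1ℤ) ≡ binomialSum M (twoStep g) x
binomialSum-twoStep g M x = begin
  (B (x + 1ℤ) + B (x + 1ℤ - 1ℤ)) + (B (x + 1ℤ - 1ℤ) + B (x + 1ℤ - 1ℤ - 1ℤ))
    ≡⟨ cong (λ y → (B (x + 1ℤ) + B y) + (B y + B (y - 1ℤ))) (cancel x) ⟩
  (B (x + 1ℤ) + B x) + (B x + B (x - 1ℤ))
    ≡⟨ collect (B (x + 1ℤ)) (B x) (B (x - 1ℤ)) ⟩
  B (x + 1ℤ) + + 2 * B x + B (x - 1ℤ)
    ≡⟨ cong₂ _+_ (cong₂ _+_ (binomialSum-shift g 1ℤ M x) (binomialSum-* (+ 2) g M x))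
                 (binomialSum-shift g (- 1ℤ) M x) ⟨
  binomialSum M (λ u → g (u + 1ℤ)) x + binomialSum M (λ u → + 2 * g u) x
    + binomialSum M (λ u → g (u - 1ℤ)) x
    ≡⟨ cong (_+ binomialSum M (λ u → g (u - 1ℤ)) x) (binomialSum-+ (λ u → g (u + 1ℤ)) (λ u → + 2 * g u) M x) ⟨
  binomialSum M (λ u → g (u + 1ℤ) + + 2 * g u) x + binomialSum M (λ u → g (u - 1ℤ)) x
    ≡⟨ binomialSum-+ (λ u → g (u + 1ℤ) + + 2 * g u) (λ u → g (u - 1ℤ)) M x ⟨
  binomialSum M (twoStep g) x ∎
  where
  B = binomialSum M g
  cancel : ∀ x → x + 1ℤ - 1ℤ ≡ x
  cancel = solve-∀
  collect : ∀ a b c → (a + b) + (b + c) ≡ a + + 2 * b + c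
  collect = solve-∀

-- centralSum n g = Σ_{k=-n}^{n} (2n C (n - k)) · g k
centralSum : ℕ → (ℤ → ℤ) → ℤ
centralSum n g = binomialSum (2 ℕ.* n) g (+ n)

centralSum-suc : ∀ n g → centralSum (suc n) g ≡ centralSum n (twoStep g)
centralSum-suc n g = begin
  binomialSum (2 ℕ.* suc n) g (+ suc n)
    ≡⟨ cong₂ (λ M x → binomialSum M g x) (ℕ.*-suc 2 n) (ℤ.+-comm 1ℤ (+ n)) ⟩
  binomialSum (suc (suc (2 ℕ.* n))) g (+ n + 1ℤ)
    ≡⟨ binomialSum-twoStep g (2 ℕ.* n) (+ n) ⟩
  centralSum n (twoStep g) ∎

-- When twoStep keeps the family h inside its linear span, the central sums of h
-- obey a linear recurrence in n, so any solution P of that recurrence with the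
-- same initial values is their closed form (p stands for 4ⁿ, x for n).
module _ {I : Set} (h : I → ℤ → ℤ) (ts : I → List (ℤ × I)) (P : I → ℤ → ℤ → ℤ)
         (twoStep-h : ∀ i u → twoStep (h i) u ≡ linComb (ts i) (λ j → h j u))
         (P-recurrence : ∀ i p x → linComb (ts i) (λ j → P j p x) ≡ P i (+ 4 * p) (1ℤ + x))
         (P-initial : ∀ i → h i 0ℤ ≡ P i 1ℤ 0ℤ)
         where

  centralSum-closedForm : ∀ n i → centralSum n (h i) ≡ P i (pow4 n) (ℤof n)
  centralSum-closedForm zero    i = P-initial i
  centralSum-closedForm (suc n) i = begin
    centralSum (suc n) (h i)
      ≡⟨ centralSum-suc n (h i) ⟩
    centralSum n (twoStep (h i))
      ≡⟨ binomialSum-cong (twoStep-h i) (2 ℕ.* n) (+ n) ⟩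
    centralSum n (λ u → linComb (ts i) (λ j → h j u))
      ≡⟨ binomialSum-linComb (ts i) h (2 ℕ.* n) (+ n) ⟩
    linComb (ts i) (λ j → centralSum n (h j))
      ≡⟨ linComb-cong (ts i) (λ j → centralSum-closedForm n j) ⟩
    linComb (ts i) (λ j → P j (pow4 n) (ℤof n))
      ≡⟨ P-recurrence i (pow4 n) (ℤof n) ⟩
    P i (+ 4 * pow4 n) (1ℤ + ℤof n)
      ≡⟨ cong (λ p → P i p (ℤof (suc n))) (ℤ.pos-* 4 (4 ℕ.^ n)) ⟨
    P i (pow4 (suc n)) (ℤof (suc n)) ∎

halfSum : (ℕ → ℕ) → ℕ → ℕ → ℕ
halfSum f M y = sum (applyUpTo (λ i → (M C (y ∸ suc i)) ℕ.* f (suc i)) y)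

A≡halfSum : ∀ m n → A m n ≡ halfSum (ℕ._^ m) (2 ℕ.* n) n
A≡halfSum m n = cong sum (map-upTo _ n)

halfSum-zero : ∀ f y → halfSum f 0 (suc y) ≡ f (suc y)
halfSum-zero f zero    = trans (ℕ.+-identityʳ _) (ℕ.*-identityˡ _)
halfSum-zero f (suc y) = halfSum-zero (f ∘ suc) y

halfSum-pascal : ∀ f M y → halfSum f (suc M) y ≡ halfSum f M y ℕ.+ halfSum f M (y ∸ 1)
halfSum-pascal f M zero          = refl
halfSum-pascal f M (suc zero)    = sym (ℕ.+-identityʳ _)
halfSum-pascal f M (suc (suc y)) = begin
  (suc M C suc y) ℕ.* f 1 ℕ.+ halfSum (f ∘ suc) (suc M) (suc y)
    ≡⟨ cong₂ (λ c s → c ℕ.* f 1 ℕ.+ s) (nCk+nC[k+1]≡[n+1]C[k+1] M y) (sym (halfSum-pascal (f ∘ suc) M (suc y))) ⟨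
  (M C y ℕ.+ M C suc y) ℕ.* f 1 ℕ.+ (halfSum (f ∘ suc) M (suc y) ℕ.+ halfSum (f ∘ suc) M y)
    ≡⟨ rearrange (M C y) (M C suc y) (f 1) (halfSum (f ∘ suc) M (suc y)) (halfSum (f ∘ suc) M y) ⟩
  ((M C suc y) ℕ.* f 1 ℕ.+ halfSum (f ∘ suc) M (suc y)) ℕ.+ ((M C y) ℕ.* f 1 ℕ.+ halfSum (f ∘ suc) M y) ∎
  where
  rearrange : ∀ a b c d e → (a ℕ.+ b) ℕ.* c ℕ.+ (d ℕ.+ e) ≡ (b ℕ.* c ℕ.+ d) ℕ.+ (a ℕ.* c ℕ.+ e)
  rearrange = ℕ-Solver.solve-∀

onPositives : (ℕ → ℕ) → ℤ → ℤ
onPositives f (+ suc k) = + f (suc k)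
onPositives f (+ zero)  = 0ℤ
onPositives f -[1+ k ]  = 0ℤ

binomialSum-onPositives-nonpositive : ∀ f M x → x ≤ 0ℤ → binomialSum M (onPositives f) x ≡ 0ℤ
binomialSum-onPositives-nonpositive f zero (+ zero)  x≤0 = refl
binomialSum-onPositives-nonpositive f zero -[1+ k ]  x≤0 = refl
binomialSum-onPositives-nonpositive f zero (+ suc k) (+≤+ ())
binomialSum-onPositives-nonpositive f (suc M) x x≤0 = cong₂ _+_
  (binomialSum-onPositives-nonpositive f M x x≤0)
  (binomialSum-onPositives-nonpositive f M (x - 1ℤ) (ℤ.i≤j⇒i-k≤j 1ℤ x≤0))

halfSum-binomialSum : ∀ f M y → + halfSum f M y ≡ binomialSum M (onPositives f) (+ y)
halfSum-binomialSum f zero    zero    = refl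
halfSum-binomialSum f zero    (suc y) = cong +_ (halfSum-zero f y)
halfSum-binomialSum f (suc M) zero    =
  sym (binomialSum-onPositives-nonpositive f (suc M) 0ℤ ℤ.≤-refl)
halfSum-binomialSum f (suc M) (suc y) = begin
  + halfSum f (suc M) (suc y)                    ≡⟨ cong +_ (halfSum-pascal f M (suc y)) ⟩
  + (halfSum f M (suc y) ℕ.+ halfSum f M y)      ≡⟨ ℤ.pos-+ (halfSum f M (suc y)) (halfSum f M y) ⟩
  + halfSum f M (suc y) + + halfSum f M y        ≡⟨ cong₂ _+_ (halfSum-binomialSum f M (suc y)) (halfSum-binomialSum f M y) ⟩
  binomialSum (suc M) (onPositives f) (+ suc y)  ∎

evenPower-onPositives : ∀ m u → u ^ (2 ℕ.* suc m) ≡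
  onPositives (ℕ._^ (2 ℕ.* suc m)) u + onPositives (ℕ._^ (2 ℕ.* suc m)) (- u)
evenPower-onPositives m (+ zero)  = 0^n≡0 (2 ℕ.* suc m)
evenPower-onPositives m (+ suc k) = trans (sym (pos-^ (suc k) (2 ℕ.* suc m))) (sym (ℤ.+-identityʳ _))
evenPower-onPositives m -[1+ k ]  = begin
  (- + suc k) ^ (2 ℕ.* suc m)  ≡⟨ [-i]^[2m]≡i^[2m] (+ suc k) (suc m) ⟩
  (+ suc k) ^ (2 ℕ.* suc m)    ≡⟨ pos-^ (suc k) (2 ℕ.* suc m) ⟨
  + (suc k ℕ.^ (2 ℕ.* suc m))  ≡⟨ ℤ.+-identityˡ _ ⟨
  0ℤ + + (suc k ℕ.^ (2 ℕ.* suc m)) ∎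

centralSum-evenPower : ∀ m n → centralSum n (_^ (2 ℕ.* suc m)) ≡ + 2 * + A (2 ℕ.* suc m) n
centralSum-evenPower m n = begin
  binomialSum (2 ℕ.* n) (_^ e) (+ n)
    ≡⟨ binomialSum-split (_^ e) f⁺ (evenPower-onPositives m) (2 ℕ.* n) (+ n) ⟩
  binomialSum (2 ℕ.* n) f⁺ (+ n) + binomialSum (2 ℕ.* n) f⁺ (+ (2 ℕ.* n) - + n)
    ≡⟨ cong (λ x → binomialSum (2 ℕ.* n) f⁺ (+ n) + binomialSum (2 ℕ.* n) f⁺ x) 2n-n≡n ⟩
  binomialSum (2 ℕ.* n) f⁺ (+ n) + binomialSum (2 ℕ.* n) f⁺ (+ n)
    ≡⟨ cong (λ s → s + s) (halfSum-binomialSum (ℕ._^ e) (2 ℕ.* n) n) ⟨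
  + halfSum (ℕ._^ e) (2 ℕ.* n) n + + halfSum (ℕ._^ e) (2 ℕ.* n) n
    ≡⟨ double (+ halfSum (ℕ._^ e) (2 ℕ.* n) n) ⟩
  + 2 * + halfSum (ℕ._^ e) (2 ℕ.* n) n
    ≡⟨ cong (λ a → + 2 * + a) (A≡halfSum e n) ⟨
  + 2 * + A e n ∎
  where
  e  = 2 ℕ.* suc m
  f⁺ = onPositives (ℕ._^ e)
  double : ∀ a → a + a ≡ + 2 * a
  double = solve-∀
  2n-n≡n : + (2 ℕ.* n) - + n ≡ + n
  2n-n≡n = trans (cong (_- + n) (ℤ.pos-* 2 n)) (twice-minus (+ n))
    where
    twice-minus : ∀ x → + 2 * x - x ≡ x
    twice-minus = solve-∀

scaledEvenPower : Fin 6 → ℤ → ℤ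
scaledEvenPower i u = + (2 ℕ.^ toℕ i) * u ^ (2 ℕ.* toℕ i)

-- By the binomial theorem, twoStep (scaledEvenPower i) is
-- 4 · scaledEvenPower i + Σ_{j<i} 2^(i-j+1) · (2i C 2j) · scaledEvenPower j.
twoStep-coefficients : Fin 6 → List (ℤ × Fin 6)
twoStep-coefficients 0F = (+ 4 , 0F) ∷ []
twoStep-coefficients 1F = (+ 4 , 0F) ∷ (+ 4 , 1F) ∷ []
twoStep-coefficients 2F = (+ 8 , 0F) ∷ (+ 24 , 1F) ∷ (+ 4 , 2F) ∷ []
twoStep-coefficients 3F = (+ 16 , 0F) ∷ (+ 120 , 1F) ∷ (+ 60 , 2F) ∷ (+ 4 , 3F) ∷ []
twoStep-coefficients 4F = (+ 32 , 0F) ∷ (+ 448 , 1F) ∷ (+ 560 , 2F) ∷ (+ 112 , 3F) ∷ (+ 4 , 4F) ∷ []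
twoStep-coefficients 5F =
  (+ 64 , 0F) ∷ (+ 1440 , 1F) ∷ (+ 3360 , 2F) ∷ (+ 1680 , 3F) ∷ (+ 180 , 4F) ∷ (+ 4 , 5F) ∷ []

closedForm : Fin 6 → ℤ → ℤ → ℤ
closedForm 0F p x = p
closedForm 1F p x = p * x
closedForm 2F p x = p * x * (+ 3 * x - + 1)
closedForm 3F p x = p * x * (+ 15 * x * x - + 15 * x + + 4)
closedForm 4F p x = p * x * (+ 105 * x * x * x - + 210 * x * x + + 147 * x - + 34)
closedForm 5F p x =
  p * x * (+ 945 * x * x * x * x - + 3150 * x * x * x + + 4095 * x * x - + 2370 * x + + 496)

twoStep-scaledEvenPower : ∀ i u →
  twoStep (scaledEvenPower i) u ≡ linComb (twoStep-coefficients i) (λ j → scaledEvenPower j u)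
twoStep-scaledEvenPower 0F u = refl
twoStep-scaledEvenPower 1F = expand
  where
  expand : ∀ u → + 2 * (u + 1ℤ) ^ 2 + + 2 * (+ 2 * u ^ 2) + + 2 * (u - 1ℤ) ^ 2
               ≡ + 4 * (+ 2 * u ^ 2) + + 4
  expand = solve-∀
twoStep-scaledEvenPower 2F = expand
  where
  expand : ∀ u → + 4 * (u + 1ℤ) ^ 4 + + 2 * (+ 4 * u ^ 4) + + 4 * (u - 1ℤ) ^ 4
               ≡ + 4 * (+ 4 * u ^ 4) + + 24 * (+ 2 * u ^ 2) + + 8
  expand = solve-∀
twoStep-scaledEvenPower 3F = expand
  where
  expand : ∀ u → + 8 * (u + 1ℤ) ^ 6 + + 2 * (+ 8 * u ^ 6) + + 8 * (u - 1ℤ) ^ 6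
               ≡ + 4 * (+ 8 * u ^ 6) + + 60 * (+ 4 * u ^ 4) + + 120 * (+ 2 * u ^ 2) + + 16
  expand = solve-∀
twoStep-scaledEvenPower 4F = expand
  where
  expand : ∀ u → + 16 * (u + 1ℤ) ^ 8 + + 2 * (+ 16 * u ^ 8) + + 16 * (u - 1ℤ) ^ 8
               ≡ + 4 * (+ 16 * u ^ 8) + + 112 * (+ 8 * u ^ 6) + + 560 * (+ 4 * u ^ 4)
                 + + 448 * (+ 2 * u ^ 2) + + 32
  expand = solve-∀
twoStep-scaledEvenPower 5F = expand
  where
  expand : ∀ u → + 32 * (u + 1ℤ) ^ 10 + + 2 * (+ 32 * u ^ 10) + + 32 * (u - 1ℤ) ^ 10
               ≡ + 4 * (+ 32 * u ^ 10) + + 180 * (+ 16 * u ^ 8) + + 1680 * (+ 8 * u ^ 6)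
                 + + 3360 * (+ 4 * u ^ 4) + + 1440 * (+ 2 * u ^ 2) + + 64
  expand = solve-∀

closedForm-recurrence : ∀ i p x →
  linComb (twoStep-coefficients i) (λ j → closedForm j p x) ≡ closedForm i (+ 4 * p) (1ℤ + x)
closedForm-recurrence 0F p x = refl
closedForm-recurrence 1F = recurrence
  where
  recurrence : ∀ p x → + 4 * (p * x) + + 4 * p ≡ (+ 4 * p) * (1ℤ + x)
  recurrence = solve-∀
closedForm-recurrence 2F = recurrence
  where
  recurrence : ∀ p x → + 4 * (p * x * (+ 3 * x - + 1)) + + 24 * (p * x) + + 8 * p
    ≡ let y = 1ℤ + x in (+ 4 * p) * y * (+ 3 * y - + 1)
  recurrence = solve-∀
closedForm-recurrence 3F = recurrence
  where
  recurrence : ∀ p x →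
    + 4 * (p * x * (+ 15 * x * x - + 15 * x + + 4)) + + 60 * (p * x * (+ 3 * x - + 1))
    + + 120 * (p * x) + + 16 * p
    ≡ let y = 1ℤ + x in (+ 4 * p) * y * (+ 15 * y * y - + 15 * y + + 4)
  recurrence = solve-∀
closedForm-recurrence 4F = recurrence
  where
  recurrence : ∀ p x →
    + 4 * (p * x * (+ 105 * x * x * x - + 210 * x * x + + 147 * x - + 34))
    + + 112 * (p * x * (+ 15 * x * x - + 15 * x + + 4)) + + 560 * (p * x * (+ 3 * x - + 1))
    + + 448 * (p * x) + + 32 * p
    ≡ let y = 1ℤ + x in (+ 4 * p) * y * (+ 105 * y * y * y - + 210 * y * y + + 147 * y - + 34)
  recurrence = solve-∀
closedForm-recurrence 5F = recurrence
  where
  recurrence : ∀ p x →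
    + 4 * (p * x * (+ 945 * x * x * x * x - + 3150 * x * x * x + + 4095 * x * x - + 2370 * x + + 496))
    + + 180 * (p * x * (+ 105 * x * x * x - + 210 * x * x + + 147 * x - + 34))
    + + 1680 * (p * x * (+ 15 * x * x - + 15 * x + + 4)) + + 3360 * (p * x * (+ 3 * x - + 1))
    + + 1440 * (p * x) + + 64 * p
    ≡ let y = 1ℤ + x in
      (+ 4 * p) * y * (+ 945 * y * y * y * y - + 3150 * y * y * y + + 4095 * y * y - + 2370 * y + + 496)
  recurrence = solve-∀

closedForm-initial : ∀ i → scaledEvenPower i 0ℤ ≡ closedForm i 1ℤ 0ℤ
closedForm-initial 0F = refl
closedForm-initial 1F = refl
closedForm-initial 2F = refl
closedForm-initial 3F = refl
closedForm-initial 4F = refl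
closedForm-initial 5F = refl

centralSum-scaledEvenPower : ∀ n i → centralSum n (scaledEvenPower i) ≡ closedForm i (pow4 n) (ℤof n)
centralSum-scaledEvenPower = centralSum-closedForm scaledEvenPower twoStep-coefficients closedForm
  twoStep-scaledEvenPower closedForm-recurrence closedForm-initial

powerSum-closedForm : ∀ (i : Fin 5) n →
  + (2 ℕ.^ (2 ℕ.+ toℕ i)) * + A (2 ℕ.* suc (toℕ i)) n ≡ closedForm (Fin.suc i) (pow4 n) (ℤof n)
powerSum-closedForm i n = begin
  + (2 ℕ.* 2 ℕ.^ k) * + A (2 ℕ.* k) n      ≡⟨ cong (_* + A (2 ℕ.* k) n) (ℤ.pos-* 2 (2 ℕ.^ k)) ⟩
  + 2 * + (2 ℕ.^ k) * + A (2 ℕ.* k) n      ≡⟨ regroup (+ 2) (+ (2 ℕ.^ k)) (+ A (2 ℕ.* k) n) ⟩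
  + (2 ℕ.^ k) * (+ 2 * + A (2 ℕ.* k) n)    ≡⟨ cong (+ (2 ℕ.^ k) *_) (centralSum-evenPower (toℕ i) n) ⟨
  + (2 ℕ.^ k) * centralSum n (_^ (2 ℕ.* k)) ≡⟨ binomialSum-* (+ (2 ℕ.^ k)) (_^ (2 ℕ.* k)) (2 ℕ.* n) (+ n) ⟨
  centralSum n (scaledEvenPower (Fin.suc i)) ≡⟨ centralSum-scaledEvenPower n (Fin.suc i) ⟩
  closedForm (Fin.suc i) (pow4 n) (ℤof n)   ∎
  where
  k = suc (toℕ i)
  regroup : ∀ a b c → a * b * c ≡ b * (a * c)
  regroup = solve-∀

corollary3 : (n : ℕ) →
    (+ 4 * + A 2 (suc n) ≡ pow4 (suc n) * ℤof (suc n))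
    × (+ 8 * + A 4 (suc n) ≡ pow4 (suc n) * ℤof (suc n) * (+ 3 * ℤof (suc n) - + 1))
    × (+ 16 * + A 6 (suc n) ≡ pow4 (suc n) * ℤof (suc n) * (+ 15 * ℤof (suc n) * ℤof (suc n) - + 15 * ℤof (suc n) + + 4))
    × (+ 32 * + A 8 (suc n) ≡ pow4 (suc n) * ℤof (suc n) * (+ 105 * ℤof (suc n) * ℤof (suc n) * ℤof (suc n) - + 210 * ℤof (suc n) * ℤof (suc n) + + 147 * ℤof (suc n) - + 34))
    × (+ 64 * + A 10 (suc n) ≡ pow4 (suc n) * ℤof (suc n) * (+ 945 * ℤof (suc n) * ℤof (suc n) * ℤof (suc n) * ℤof (suc n) - + 3150 * ℤof (suc n) * ℤof (suc n) * ℤof (suc n) + + 4095 * ℤof (suc n) * ℤof (suc n) - + 2370 * ℤof (suc n) + + 496))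
corollary3 n =
    powerSum-closedForm 0F (suc n)
  , powerSum-closedForm 1F (suc n)
  , powerSum-closedForm 2F (suc n)
  , powerSum-closedForm 3F (suc n)
  , powerSum-closedForm 4F (suc n)
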